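{- For every positive integer $n$: if $d(n)=0$ then $d(n+1)=1$; if $d(n)=1$ then $d(n+1)\in\{0,2\}$; if $d(n)=2$ then $d(n+1)=0$.
   Context: Fibonacci numbers: $F_0=0,F_1=1,F_n=F_{n-1}+F_{n-2}$. Zeckendorf expansion: every positive integer $n$ is uniquely $n=\sum_{j\ge0}\epsilon_jF_{j+2}$ with $\epsilon_j\in\{0,1\}$, finitely many nonzero, $\epsilon_j\epsilon_{j+1}=0$. Let $k(n)=\min\{j:\epsilon_j=1\}$ and set $d(n)=0$ if $k(n)=0$, $d(n)=1$ if $k(n)$ is odd, $d(n)=2$ if $k(n)$ is even and $\ge2$. -}

module Defs where

open import Data.Nat using (ℕ; zero; suc; _+_; _*_; _%_; _≡ᵇ_)
open import Relation.Binary.PropositionalEquality using (_≡_)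
open import Data.Product using (∃-syntax)
open import Data.Bool using (Bool; true; false; if_then_else_)
open import Data.List using (List; []; _∷_)
open import Data.Empty using (⊥)
open import Data.Unit using (⊤)
open import Data.Product using (_×_)

F : ℕ → ℕ
F zero = 0
F (suc zero) = 1
F (suc (suc n)) = F (suc n) + F n

bit : Bool → ℕ
bit true = 1
bit false = 0

valFrom : ℕ → List Bool → ℕ
valFrom j [] = 0
valFrom j (e ∷ es) = bit e * F (j + 2) + valFrom (suc j) es

val : List Bool → ℕ
val = valFrom 0

NoConsecOnes : List Bool → Set
NoConsecOnes [] = ⊤
NoConsecOnes (true ∷ true ∷ es) = ⊥
NoConsecOnes (e ∷ es) = NoConsecOnes es

IsZeckendorf : ℕ → List Bool → Set
IsZeckendorf n ε = NoConsecOnes ε × val ε ≡ n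

data MinIndex : List Bool → ℕ → Set where
  here  : ∀ {es} → MinIndex (true ∷ es) 0
  there : ∀ {es k} → MinIndex es k → MinIndex (false ∷ es) (suc k)

dOfK : ℕ → ℕ
dOfK k with k % 2
... | zero = if k ≡ᵇ 0 then 0 else 2
... | suc _ = 1

-- d(n) = δ : the Zeckendorf expansion ε of n has least index k(n) = k with d-value δ
-- (expansion is unique for n ≥ 1, so this determines d(n))
D : ℕ → ℕ → Set
D n δ = ∃[ ε ] ∃[ k ] (IsZeckendorf n ε × MinIndex ε k × dOfK k ≡ δ)

-- Adding 1 to a Zeckendorf expansion is a carry: F₂ + F₂ = F₃ and F_j + F_{j+1} = F_{j+2}.
-- If k(n) = 0 the carry starts at index 1, if k(n) = 1 at index 2, and in both cases it
-- stops at an index of the same parity as its start, so k(n+1) is odd resp. even ≥ 2.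
-- If k(n) ≥ 2 then ε₀ = ε₁ = 0, and n+1 is obtained by setting ε₀ = 1.
module Submission where

open import Defs
open import Data.Nat using (ℕ; zero; suc; _≤_; _+_; _%_)
open import Data.Nat.Properties using (+-comm; +-assoc; *-identityˡ)
open import Data.Product using (_×_; _,_; ∃-syntax)
open import Data.Sum using (_⊎_; inj₁; inj₂)
open import Data.Bool using (Bool; true; false)
open import Data.List using (List; []; _∷_)
open import Data.Empty using (⊥; ⊥-elim)
open import Data.Unit using (⊤; tt)
open import Relation.Nullary using (¬_)
open import Relation.Binary.PropositionalEquality
  using (_≡_; refl; sym; trans; cong; module ≡-Reasoning)

data Even : ℕ → Set where
  zero : Even 0
  2+_  : ∀ {k} → Even k → Even (suc (suc k))

even⇒%2≡0 : ∀ {k} → Even k → k % 2 ≡ 0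
even⇒%2≡0 zero   = refl
even⇒%2≡0 (2+ e) = even⇒%2≡0 e

even⇒suc%2≡1 : ∀ {k} → Even k → suc k % 2 ≡ 1
even⇒suc%2≡1 zero   = refl
even⇒suc%2≡1 (2+ e) = even⇒suc%2≡1 e

dOfK-suc≢0 : ∀ k → ¬ dOfK (suc k) ≡ 0
dOfK-suc≢0 k with suc k % 2
... | zero  = λ ()
... | suc _ = λ ()

dOfK-suc-even : ∀ {k} → Even k → dOfK (suc k) ≡ 1
dOfK-suc-even e rewrite even⇒suc%2≡1 e = refl

dOfK-2+even : ∀ {k} → Even k → dOfK (suc (suc k)) ≡ 2
dOfK-2+even e rewrite even⇒%2≡0 e = refl

F[j+2]+F[j+3]≡F[j+4] : ∀ j → F (j + 2) + F (suc j + 2) ≡ F (suc (suc j) + 2)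
F[j+2]+F[j+3]≡F[j+4] j rewrite +-comm j 2 = +-comm (F (suc (suc j))) _

valFrom-true : ∀ j r → valFrom j (true ∷ r) ≡ F (j + 2) + valFrom (suc j) r
valFrom-true j r = cong (_+ valFrom (suc j) r) (*-identityˡ (F (j + 2)))

NoLeadingOne : List Bool → Set
NoLeadingOne (true ∷ _) = ⊥
NoLeadingOne _          = ⊤

noConsecOnes-tail : ∀ r → NoConsecOnes (true ∷ r) → NoLeadingOne r × NoConsecOnes r
noConsecOnes-tail []          _  = tt , tt
noConsecOnes-tail (false ∷ r) nc = tt , nc
noConsecOnes-tail (true ∷ r)  ()

carry : ∀ j w → NoLeadingOne w → NoConsecOnes w →
  ∃[ w′ ] ∃[ m ] NoConsecOnes w′ × valFrom j w′ ≡ F (j + 2) + valFrom j w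
               × MinIndex w′ m × Even m
carry j []                  _ _  = true ∷ [] , 0 , tt , valFrom-true j [] , here , zero
carry j (false ∷ [])        _ _  = true ∷ [] , 0 , tt , valFrom-true j [] , here , zero
carry j (false ∷ false ∷ r) _ nc =
  true ∷ false ∷ r , 0 , nc , valFrom-true j (false ∷ r) , here , zero
carry j (false ∷ true ∷ r)  _ nc with noConsecOnes-tail r nc
... | nlo , nc′ with carry (suc (suc j)) r nlo nc′
... | w′ , m , nc″ , v , mi , e =
  false ∷ false ∷ w′ , suc (suc m) , nc″ , value , there (there mi) , 2+ e
  where
  open ≡-Reasoning
  value : valFrom (suc (suc j)) w′ ≡ F (j + 2) + valFrom (suc j) (true ∷ r)
  value = begin
    valFrom (suc (suc j)) w′
      ≡⟨ v ⟩
    F (suc (suc j) + 2) + valFrom (suc (suc j)) r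
      ≡⟨ cong (_+ valFrom (suc (suc j)) r) (sym (F[j+2]+F[j+3]≡F[j+4] j)) ⟩
    (F (j + 2) + F (suc j + 2)) + valFrom (suc (suc j)) r
      ≡⟨ +-assoc (F (j + 2)) _ _ ⟩
    F (j + 2) + (F (suc j + 2) + valFrom (suc (suc j)) r)
      ≡⟨ cong (F (j + 2) +_) (sym (valFrom-true (suc j) r)) ⟩
    F (j + 2) + valFrom (suc j) (true ∷ r)
      ∎
carry j (true ∷ r) () _

k≡0⇒D[1+n]1 : ∀ {n ε} → IsZeckendorf n ε → MinIndex ε 0 → D (suc n) 1
k≡0⇒D[1+n]1 {ε = true ∷ w} (nc , v) here with noConsecOnes-tail w nc
... | nlo , nc′ with carry 1 w nlo nc′
... | w′ , m , nc″ , v′ , mi , e = false ∷ w′ , suc m , (nc″ , trans v′ (cong suc v)) , there mi , dOfK-suc-even e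

k≡1⇒D[1+n]2 : ∀ {n ε} → IsZeckendorf n ε → MinIndex ε 1 → D (suc n) 2
k≡1⇒D[1+n]2 {ε = false ∷ true ∷ r} (nc , v) (there here) with noConsecOnes-tail r nc
... | nlo , nc′ with carry 2 r nlo nc′
... | w′ , m , nc″ , v′ , mi , e =
  false ∷ false ∷ w′ , suc (suc m) , (nc″ , trans v′ (cong suc v)) , there (there mi) , dOfK-2+even e

k≥2⇒D[1+n]0 : ∀ {n ε k} → IsZeckendorf n ε → MinIndex ε (suc (suc k)) → D (suc n) 0
k≥2⇒D[1+n]0 {ε = false ∷ false ∷ r} (nc , v) (there (there _)) =
  true ∷ false ∷ r , 0 , (nc , cong suc v) , here , refl

proposition4 : (n : ℕ) → 1 ≤ n →
    (D n 0 → D (suc n) 1) × (D n 1 → D (suc n) 0 ⊎ D (suc n) 2) × (D n 2 → D (suc n) 0)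
proposition4 n _ = from-d≡0 , from-d≡1 , from-d≡2
  where
  from-d≡0 : D n 0 → D (suc n) 1
  from-d≡0 (_ , zero  , z , mi , _) = k≡0⇒D[1+n]1 z mi
  from-d≡0 (_ , suc k , _ , _  , d) = ⊥-elim (dOfK-suc≢0 k d)

  from-d≡1 : D n 1 → D (suc n) 0 ⊎ D (suc n) 2
  from-d≡1 (_ , zero        , _ , _  , ())
  from-d≡1 (_ , suc zero    , z , mi , _) = inj₂ (k≡1⇒D[1+n]2 z mi)
  from-d≡1 (_ , suc (suc k) , z , mi , _) = inj₁ (k≥2⇒D[1+n]0 z mi)

  from-d≡2 : D n 2 → D (suc n) 0
  from-d≡2 (_ , zero        , _ , _  , ())
  from-d≡2 (_ , suc zero    , _ , _  , ())
  from-d≡2 (_ , suc (suc k) , z , mi , _) = k≥2⇒D[1+n]0 z mi
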